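{- Let $\Gamma$ be a connected bipartite graph with color classes $Y,Y'$ that is distance-semiregular with respect to $Y$, with intersection numbers $b_i,c_i$ $(0\le i\le 4)$, and assume every vertex of $Y$ has eccentricity $4$. Let $b'_0$ denote the (common) valency of the vertices of $Y'$. Then the incidence structure with point set $Y$, block set $Y'$ and incidence given by adjacency in $\Gamma$ is a $(v,b,r,k,\lambda_1,0)$ SPBIBD of type $(b_1,c_3)$ with $$v=1+\frac{b_0b_1}{c_2}+\frac{b_0b_1b_2b_3}{c_2c_3c_4},\quad b=b_0+\frac{b_0b_1b_2}{c_2c_3},\quad r=b_0,\quad k=b'_0,\quad \lambda_1=c_2;$$ in particular $\Gamma$ is its incidence graph.
   Context: $\Gamma_i(u)$ is the set of vertices at graph distance $i$ from $u$, $\Gamma(u)=\Gamma_1(u)$, eccentricity of $u$ is the maximum distance from $u$. A connected bipartite graph with color classes $Y,Y'$ is distance-semiregular with respect to $Y$ if there are constants $b_i,c_i$ such that for every $u\in Y$, every $i$ and every $w\in\Gamma_i(u)$, $|\Gamma_{i+1}(u)\cap\Gamma(w)|=b_i$ and $|\Gamma_{i-1}(u)\cap\Gamma(w)|=c_i$ (such a graph is biregular). An incidence structure $\mathcal D=(\mathcal P,\mathcal B,\mathcal I)$ has finite point set $\mathcal P$, block set $\mathcal B$, incidence $\mathcal I\subseteq\mathcal P\times\mathcal B$ (write $p\in B$). $(p,B)$ is a flag if $p\in B$, a non-flag otherwise. A $(v,b,r,k,\lambda_1,\lambda_2)$ SPBIBD of type $(s,t)$: $|\mathcal P|=v$, $|\mathcal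 B|=b$, each block has $k$ points, each point lies in $r$ blocks; any two distinct points lie together in exactly $\lambda_1$ or exactly $\lambda_2$ blocks; for every flag $(p,B)$ exactly $s$ points of $B$ other than $p$ lie together with $p$ in exactly $\lambda_1$ blocks; for every non-flag $(p,B)$ exactly $t$ points of $B$ lie together with $p$ in exactly $\lambda_1$ blocks. The incidence graph is the bipartite graph on $\mathcal P\cup\mathcal B$ with $p\sim B$ iff $p\in B$. -}

module Defs where

open import Data.Nat using (ℕ; zero; suc; _+_; _*_)
open import Data.Bool using (Bool; true; false; _∧_; _∨_; not; if_then_else_)
open import Data.Fin using (Fin; zero; suc; _≟_)
open import Data.Product using (Σ; ∃; _×_)
open import Data.Sum using (_⊎_)
open import Relation.Nullary using (¬_)
open import Relation.Nullary.Decidable using (⌊_⌋)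
open import Relation.Binary.PropositionalEquality using (_≡_; _≢_)

count : ∀ {n} → (Fin n → Bool) → ℕ
count {zero}  f = 0
count {suc n} f = (if f zero then 1 else 0) + count (λ i → f (suc i))

anyF : ∀ {n} → (Fin n → Bool) → Bool
anyF {zero}  f = false
anyF {suc n} f = f zero ∨ anyF (λ i → f (suc i))

record Graph (n : ℕ) : Set where
  field
    adj   : Fin n → Fin n → Bool
    sym   : ∀ x y → adj x y ≡ adj y x
    irrefl : ∀ x → adj x x ≡ false

module _ {n : ℕ} (G : Graph n) where
  open Graph G

  -- reach k u w = true  iff  d(u,w) ≤ k
  reach : ℕ → Fin n → Fin n → Bool
  reach zero    u w = ⌊ u ≟ w ⌋
  reach (suc k) u w = reach k u w ∨ anyF (λ x → reach k u x ∧ adj x w)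

  inDist : ℕ → Fin n → Fin n → Bool
  inDist zero    u w = reach zero u w
  inDist (suc i) u w = reach (suc i) u w ∧ not (reach i u w)

  Connected : Set
  Connected = ∀ u w → ∃ λ k → reach k u w ≡ true

  deg : Fin n → ℕ
  deg w = count (adj w)

  nbrsAt : ℕ → Fin n → Fin n → ℕ
  nbrsAt j u w = count (λ x → adj w x ∧ inDist j u x)

  -- col is a proper 2-colouring with both colour classes nonempty;
  -- Y = { x | col x ≡ true },  Y' = { x | col x ≡ false }
  IsBipartition : (Fin n → Bool) → Set
  IsBipartition col =
    (∀ x y → adj x y ≡ true → col x ≢ col y)
    × (∃ λ y → col y ≡ true) × (∃ λ y → col y ≡ false)

  -- distance-semiregular w.r.t. Y (= col true) with intersection numbers b, c
  -- (c i only constrained for i ≥ 1, since Γ_{-1}(u) = ∅ gives c₀ = 0)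
  DistSemiregular : (Fin n → Bool) → (ℕ → ℕ) → (ℕ → ℕ) → Set
  DistSemiregular col b c =
    (∀ u i w → col u ≡ true → inDist i u w ≡ true → nbrsAt (suc i) u w ≡ b i)
    × (∀ u i w → col u ≡ true → inDist (suc i) u w ≡ true → nbrsAt i u w ≡ c (suc i))

  Eccentricity : Fin n → ℕ → Set
  Eccentricity u e = (∀ w → reach e u w ≡ true) × (∃ λ w → inDist e u w ≡ true)

record IncStr (n : ℕ) : Set where
  field
    isPoint : Fin n → Bool
    isBlock : Fin n → Bool
    inc     : Fin n → Fin n → Bool

module _ {n : ℕ} (D : IncStr n) where
  open IncStr D

  lam : Fin n → Fin n → ℕ
  lam p q = count (λ B → isBlock B ∧ inc p B ∧ inc q B)

  record IsSPBIBD (v b r k λ₁ λ₂ s t : ℕ) : Set where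
    field
      nPoints : count isPoint ≡ v
      nBlocks : count isBlock ≡ b
      blockSize : ∀ B → isBlock B ≡ true → count (λ p → isPoint p ∧ inc p B) ≡ k
      repl : ∀ p → isPoint p ≡ true → count (λ B → isBlock B ∧ inc p B) ≡ r
      pairs : ∀ p q → isPoint p ≡ true → isPoint q ≡ true → p ≢ q →
              (lam p q ≡ λ₁) ⊎ (lam p q ≡ λ₂)
      flagCount : ∀ p B → isPoint p ≡ true → isBlock B ≡ true → inc p B ≡ true →
                  count (λ q → isPoint q ∧ inc q B ∧ not ⌊ q ≟ p ⌋
                               ∧ ⌊ lam p q Data.Nat.≟ λ₁ ⌋) ≡ s
      nonflagCount : ∀ p B → isPoint p ≡ true → isBlock B ≡ true → inc p B ≡ false →
                  count (λ q → isPoint q ∧ inc q B ∧ ⌊ lam p q Data.Nat.≟ λ₁ ⌋) ≡ t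

pointsBlocks : ∀ {n} → Graph n → (Fin n → Bool) → IncStr n
pointsBlocks G col = record
  { isPoint = col
  ; isBlock = λ x → not (col x)
  ; inc     = Graph.adj G }

-- Fix a point u ∈ Y. Bipartiteness and eccentricity 4 put Y into the layers
-- Γ₀(u) ∪ Γ₂(u) ∪ Γ₄(u) and Y' into Γ₁(u) ∪ Γ₃(u), and double counting the
-- edges between consecutive layers gives |Γᵢ(u)| bᵢ = |Γᵢ₊₁(u)| cᵢ₊₁, which
-- yields v and b. Two points p ≠ q lie in a common block iff d(p,q) = 2, and
-- then in exactly c₂ of them; so λ(p,q) = c₂ singles out Γ₂(p), and the flag
-- and non-flag counts are |Γ₂(p) ∩ Γ(B)|, equal to b₁ when d(p,B) = 1 and
-- to c₃ when d(p,B) = 3.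
module Submission where

open import Defs
open import Data.Nat using (ℕ; zero; suc; _+_; _*_; _≤_; _<_; _≤′_; ≤′-reflexive; ≤′-step; z≤n; s≤s)
import Data.Nat as ℕ
open import Data.Nat.Properties
  using (+-0-commutativeMonoid; +-suc; ≤-refl; ≤⇒≤′; m≤n⇒m≤1+n; m≤n⇒m<n∨m≡n; <-cmp; *-distribʳ-+)
open import Algebra.Properties.CommutativeMonoid.Sum +-0-commutativeMonoid using (sum; ∑-comm; sum-cong-≗)
open import Data.Nat.Tactic.RingSolver using (solve-∀)
open import Data.Bool using (Bool; true; false; _∧_; _∨_; not; if_then_else_)
open import Data.Bool.Properties using (¬-not; not-¬; ⇔→≡; ∧-comm; ∧-idem; ∧-zeroʳ; ∧-identityʳ)
open import Data.Fin using (Fin; zero; suc; _≟_)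
open import Data.Product using (∃; _×_; _,_; proj₁; proj₂)
open import Data.Sum using (_⊎_; inj₁; inj₂; [_,_])
open import Data.Empty using (⊥; ⊥-elim)
open import Function using (_∘_; _⇔_; mk⇔)
open import Relation.Nullary using (Dec; yes; no; ¬_; contradiction)
open import Relation.Nullary.Decidable using (⌊_⌋; ⌊⌋-map′)
open import Relation.Binary.Definitions using (tri<; tri≈; tri>)
open import Relation.Binary.PropositionalEquality
  using (_≡_; _≢_; _≗_; refl; sym; trans; cong; cong₂; subst; module ≡-Reasoning)

open ≡-Reasoning

∧-true : ∀ {x y} → x ≡ true → y ≡ true → x ∧ y ≡ true
∧-true refl refl = refl

∧-trueˡ : ∀ {x y} → x ∧ y ≡ true → x ≡ true
∧-trueˡ {true} _ = refl

∧-trueʳ : ∀ {x y} → x ∧ y ≡ true → y ≡ true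
∧-trueʳ {true} e = e

∨-trueˡ : ∀ {x y} → x ≡ true → x ∨ y ≡ true
∨-trueˡ refl = refl

∨-trueʳ : ∀ {x y} → y ≡ true → x ∨ y ≡ true
∨-trueʳ {true} _ = refl
∨-trueʳ {false} e = e

∨-true⁻ : ∀ {x y} → x ∨ y ≡ true → x ≡ true ⊎ y ≡ true
∨-true⁻ {true} _ = inj₁ refl
∨-true⁻ {false} e = inj₂ e

not-true⁻ : ∀ {x} → not x ≡ true → x ≡ false
not-true⁻ {false} _ = refl

⌊⌋-yes : ∀ {a} {A : Set a} (a? : Dec A) → A → ⌊ a? ⌋ ≡ true
⌊⌋-yes (yes _) _ = refl
⌊⌋-yes (no ¬a) a = contradiction a ¬a

⌊⌋-no : ∀ {a} {A : Set a} (a? : Dec A) → ¬ A → ⌊ a? ⌋ ≡ false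
⌊⌋-no (yes a) ¬a = contradiction a ¬a
⌊⌋-no (no _) _ = refl

⌊⌋-yes⁻¹ : ∀ {a} {A : Set a} (a? : Dec A) → ⌊ a? ⌋ ≡ true → A
⌊⌋-yes⁻¹ (yes a) _ = a

⌊⌋-no⁻¹ : ∀ {a} {A : Set a} (a? : Dec A) → ⌊ a? ⌋ ≡ false → ¬ A
⌊⌋-no⁻¹ (no ¬a) _ = ¬a

count-cong : ∀ {n} {f g : Fin n → Bool} → f ≗ g → count f ≡ count g
count-cong {zero} _ = refl
count-cong {suc n} f≗g = cong₂ _+_ (cong (λ x → if x then 1 else 0) (f≗g zero)) (count-cong (f≗g ∘ suc))

count-cong-⇔ : ∀ {n} {f g : Fin n → Bool} → (∀ i → f i ≡ true ⇔ g i ≡ true) → count f ≡ count g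
count-cong-⇔ f⇔g = count-cong (⇔→≡ ∘ f⇔g)

count-none : ∀ {n} {f : Fin n → Bool} → (∀ i → f i ≡ false) → count f ≡ 0
count-none {zero} _ = refl
count-none {suc n} {f} none with f zero | none zero
... | false | _ = count-none (none ∘ suc)

count≡0⇒false : ∀ {n} {f : Fin n → Bool} (i : Fin n) → count f ≡ 0 → f i ≡ false
count≡0⇒false {f = f} zero count≡0 with f zero
... | false = refl
count≡0⇒false {f = f} (suc i) count≡0 with f zero
... | false = count≡0⇒false i count≡0

count-≟ : ∀ {n} (u : Fin n) → count (λ x → ⌊ u ≟ x ⌋) ≡ 1
count-≟ {suc n} zero = cong suc (count-none {n} (λ _ → refl))
count-≟ (suc u) = trans (count-cong (λ x → ⌊⌋-map′ _ _ (u ≟ x))) (count-≟ u)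

count-∨ : ∀ {n} {f g : Fin n → Bool} → (∀ i → f i ≡ true → g i ≡ true → ⊥) →
          count (λ i → f i ∨ g i) ≡ count f + count g
count-∨ {zero} _ = refl
count-∨ {suc n} {f} {g} disjoint with f zero | g zero | disjoint zero
... | true  | true  | d = ⊥-elim (d refl refl)
... | true  | false | _ = cong suc (count-∨ (disjoint ∘ suc))
... | false | true  | _ = trans (cong suc (count-∨ (disjoint ∘ suc))) (sym (+-suc _ _))
... | false | false | _ = count-∨ (disjoint ∘ suc)

anyF-true : ∀ {n} {f : Fin n → Bool} (i : Fin n) → f i ≡ true → anyF f ≡ true
anyF-true zero e = ∨-trueˡ e
anyF-true {f = f} (suc i) e = ∨-trueʳ {f zero} (anyF-true i e)

anyF-true⁻ : ∀ {n} {f : Fin n → Bool} → anyF f ≡ true → ∃ λ i → f i ≡ true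
anyF-true⁻ {suc n} {f} e with ∨-true⁻ {f zero} e
... | inj₁ e₀ = zero , e₀
... | inj₂ e₊ with anyF-true⁻ {f = f ∘ suc} e₊
... | i , eᵢ = suc i , eᵢ

count≡sum : ∀ {n} (f : Fin n → Bool) → count f ≡ sum (λ i → if f i then 1 else 0)
count≡sum {zero} f = refl
count≡sum {suc n} f = cong ((if f zero then 1 else 0) +_) (count≡sum (f ∘ suc))

sum-if≡count* : ∀ {n} (f : Fin n → Bool) (k : ℕ) → sum (λ i → if f i then k else 0) ≡ count f * k
sum-if≡count* {zero} f k = refl
sum-if≡count* {suc n} f k with f zero
... | true = cong (k +_) (sum-if≡count* (f ∘ suc) k)
... | false = sum-if≡count* (f ∘ suc) k

double-count : ∀ {m n} (R : Fin m → Fin n → Bool) {f : Fin m → Bool} {g : Fin n → Bool} {k l : ℕ} →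
  (∀ w → count (R w) ≡ (if f w then k else 0)) →
  (∀ x → count (λ w → R w x) ≡ (if g x then l else 0)) →
  count f * k ≡ count g * l
double-count R {f} {g} {k} {l} rows columns = begin
  count f * k                                      ≡⟨ sym (sum-if≡count* f k) ⟩
  sum (λ w → if f w then k else 0)                 ≡⟨ sum-cong-≗ (sym ∘ rows) ⟩
  sum (λ w → count (R w))                          ≡⟨ sum-cong-≗ (count≡sum ∘ R) ⟩
  sum (λ w → sum (λ x → if R w x then 1 else 0))   ≡⟨ ∑-comm (λ w x → if R w x then 1 else 0) ⟩
  sum (λ x → sum (λ w → if R w x then 1 else 0))   ≡⟨ sum-cong-≗ (λ x → sym (count≡sum (λ w → R w x))) ⟩
  sum (λ x → count (λ w → R w x))                  ≡⟨ sum-cong-≗ columns ⟩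
  sum (λ x → if g x then l else 0)                 ≡⟨ sum-if≡count* g l ⟩
  count g * l                                      ∎

module Distance {n} (G : Graph n) where
  open Graph G using (adj; irrefl)

  reach-refl : ∀ k u → reach G k u u ≡ true
  reach-refl zero u = ⌊⌋-yes (u ≟ u) refl
  reach-refl (suc k) u = ∨-trueˡ (reach-refl k u)

  reach-adj : ∀ k u x w → reach G k u x ≡ true → adj x w ≡ true → reach G (suc k) u w ≡ true
  reach-adj k u x w r a = ∨-trueʳ {reach G k u w} (anyF-true x (∧-true r a))

  reach-mono : ∀ {k m} u w → k ≤ m → reach G k u w ≡ true → reach G m u w ≡ true
  reach-mono u w k≤m = go (≤⇒≤′ k≤m)
    where
    go : ∀ {k m} → k ≤′ m → reach G k u w ≡ true → reach G m u w ≡ true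
    go (≤′-reflexive refl) r = r
    go (≤′-step k≤′m) r = ∨-trueˡ (go k≤′m r)

  inDist⇒reach : ∀ j u w → inDist G j u w ≡ true → reach G j u w ≡ true
  inDist⇒reach zero u w d = d
  inDist⇒reach (suc j) u w d = ∧-trueˡ {reach G (suc j) u w} d

  inDist-suc⇒unreached : ∀ j u w → inDist G (suc j) u w ≡ true → reach G j u w ≡ false
  inDist-suc⇒unreached j u w d = not-true⁻ (∧-trueʳ {reach G (suc j) u w} d)

  inDist-suc⇒≢ : ∀ j u w → inDist G (suc j) u w ≡ true → u ≢ w
  inDist-suc⇒≢ j u .u d refl = not-¬ (reach-refl j u) (inDist-suc⇒unreached j u u d)

  reach⇒inDist : ∀ k u w → reach G k u w ≡ true → ∃ λ j → j ≤ k × inDist G j u w ≡ true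
  reach⇒inDist zero u w r = 0 , z≤n , r
  reach⇒inDist (suc k) u w r with reach G k u w in rₖ
  ... | true  = let (j , j≤k , d) = reach⇒inDist k u w rₖ in j , m≤n⇒m≤1+n j≤k , d
  ... | false = suc k , ≤-refl , ∧-true (∨-trueʳ {reach G k u w} r) (cong not rₖ)

  inDist-<-exclusive : ∀ {i j} u w → i < j → inDist G i u w ≡ true → inDist G j u w ≢ true
  inDist-<-exclusive {i} {suc j} u w (s≤s i≤j) dᵢ dⱼ =
    not-¬ (reach-mono u w i≤j (inDist⇒reach i u w dᵢ)) (inDist-suc⇒unreached j u w dⱼ)

  inDist-functional : ∀ {i j} u w → inDist G i u w ≡ true → inDist G j u w ≡ true → i ≡ j
  inDist-functional {i} {j} u w dᵢ dⱼ with <-cmp i j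
  ... | tri< i<j _ _ = contradiction dⱼ (inDist-<-exclusive u w i<j dᵢ)
  ... | tri≈ _ i≡j _ = i≡j
  ... | tri> _ _ j<i = contradiction dᵢ (inDist-<-exclusive u w j<i dⱼ)

  inDist-pred : ∀ i u w → inDist G (suc i) u w ≡ true → ∃ λ x → inDist G i u x ≡ true × adj x w ≡ true
  inDist-pred i u w d with ∨-true⁻ {reach G i u w} (inDist⇒reach (suc i) u w d)
  ... | inj₁ rᵢ = ⊥-elim (not-¬ rᵢ (inDist-suc⇒unreached i u w d))
  ... | inj₂ some with anyF-true⁻ some
  ... | x , r∧a with reach⇒inDist i u x (∧-trueˡ r∧a)
  ... | j , j≤i , dⱼ with m≤n⇒m<n∨m≡n j≤i
  ... | inj₂ refl = x , dⱼ , ∧-trueʳ r∧a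
  ... | inj₁ j<i = ⊥-elim (not-¬ (reach-mono u w j<i (reach-adj j u x w (inDist⇒reach j u x dⱼ) (∧-trueʳ r∧a)))
                                  (inDist-suc⇒unreached i u w d))

  inDist-down : ∀ {i j} u w → i ≤ j → inDist G j u w ≡ true → ∃ λ x → inDist G i u x ≡ true
  inDist-down u w i≤j = go w (≤⇒≤′ i≤j)
    where
    go : ∀ {i j} w → i ≤′ j → inDist G j u w ≡ true → ∃ λ x → inDist G i u x ≡ true
    go w (≤′-reflexive refl) d = w , d
    go {j = suc j} w (≤′-step i≤′j) d = let (x , dx , _) = inDist-pred j u w d in go x i≤′j dx

  inDist-zero : ∀ u w → inDist G 0 u w ≡ true → u ≡ w
  inDist-zero u w = ⌊⌋-yes⁻¹ (u ≟ w)

  inDist-one : ∀ u w → inDist G 1 u w ≡ adj u w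
  inDist-one u w = ⇔→≡ (mk⇔ to from)
    where
    to : inDist G 1 u w ≡ true → adj u w ≡ true
    to d = let (x , d₀ , a) = inDist-pred 0 u w d in subst (λ z → adj z w ≡ true) (sym (inDist-zero u x d₀)) a
    from : adj u w ≡ true → inDist G 1 u w ≡ true
    from a = ∧-true (reach-adj 0 u u w (reach-refl 0 u) a) (cong not (⌊⌋-no (u ≟ w) u≢w))
      where
      u≢w : u ≢ w
      u≢w refl = not-¬ a (irrefl u)

isEven : ℕ → Bool
isEven zero = true
isEven (suc i) = not (isEven i)

module Bipartite {n} (G : Graph n) (col : Fin n → Bool)
                 (proper : ∀ x y → Graph.adj G x y ≡ true → col x ≢ col y) where
  open Graph G using (adj) renaming (sym to adj-sym)
  open Distance G

  colour-flip : ∀ x y → adj x y ≡ true → col y ≡ not (col x)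
  colour-flip x y a = ¬-not (λ e → proper x y a (sym e))

  Y-adj⇒Y' : ∀ x y → col x ≡ true → adj x y ≡ true → col y ≡ false
  Y-adj⇒Y' x y cx a = trans (colour-flip x y a) (cong not cx)

  Y'-adj⇒Y : ∀ x y → col y ≡ false → adj x y ≡ true → col x ≡ true
  Y'-adj⇒Y x y cy a = trans (colour-flip y x (trans (adj-sym y x) a)) (cong not cy)

  inDist-colour : ∀ i u w → col u ≡ true → inDist G i u w ≡ true → col w ≡ isEven i
  inDist-colour zero u w cu d = subst (λ z → col z ≡ true) (inDist-zero u w d) cu
  inDist-colour (suc i) u w cu d =
    let (x , dx , a) = inDist-pred i u w d in trans (colour-flip x w a) (cong not (inDist-colour i u x cu dx))

  walk₂-end : ∀ x y z → col x ≡ true → adj x y ≡ true → adj y z ≡ true → x ≡ z ⊎ inDist G 2 x z ≡ true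
  walk₂-end x y z cx axy ayz
    with reach⇒inDist 2 x z (reach-adj 1 x y z (reach-adj 0 x x y (reach-refl 0 x) axy) ayz)
  ... | 0 , _ , d = inj₁ (inDist-zero x z d)
  ... | 1 , _ , d = ⊥-elim (not-¬ (Y'-adj⇒Y z y (Y-adj⇒Y' x y cx axy) (trans (adj-sym z y) ayz))
                                  (inDist-colour 1 x z cx d))
  ... | 2 , _ , d = inj₂ d
  ... | suc (suc (suc _)) , s≤s (s≤s ()) , _

product-step : ∀ k k′ {P Q β γ : ℕ} → k * P ≡ Q → k * β ≡ k′ * γ → k′ * (P * γ) ≡ Q * β
product-step k k′ {P} {Q} {β} {γ} kP≡Q kβ≡k′γ = begin
  k′ * (P * γ)  ≡⟨ *-assoc-swap k′ P γ ⟩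
  k′ * γ * P    ≡⟨ cong (_* P) (sym kβ≡k′γ) ⟩
  k * β * P     ≡⟨ *-swap k β P ⟩
  k * P * β     ≡⟨ cong (_* β) kP≡Q ⟩
  Q * β         ∎
  where
  *-assoc-swap : ∀ x y z → x * (y * z) ≡ x * z * y
  *-assoc-swap = solve-∀
  *-swap : ∀ x y z → x * y * z ≡ x * z * y
  *-swap = solve-∀

module Semiregular {n} (G : Graph n) (col : Fin n → Bool) (b c : ℕ → ℕ)
  (bip : IsBipartition G col) (dsr : DistSemiregular G col b c)
  (ecc : ∀ u → col u ≡ true → Eccentricity G u 4) where
  open Graph G using (adj) renaming (sym to adj-sym)
  open Distance G
  open Bipartite G col (proj₁ bip)

  D : IncStr n
  D = pointsBlocks G col

  b-count : ∀ {u} i w → col u ≡ true → inDist G i u w ≡ true → nbrsAt G (suc i) u w ≡ b i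
  b-count i w cu = proj₁ dsr _ i w cu

  c-count : ∀ {u} i w → col u ≡ true → inDist G (suc i) u w ≡ true → nbrsAt G i u w ≡ c (suc i)
  c-count i w cu = proj₂ dsr _ i w cu

  u₀ : Fin n
  u₀ = proj₁ (proj₁ (proj₂ bip))

  u₀∈Y : col u₀ ≡ true
  u₀∈Y = proj₂ (proj₁ (proj₂ bip))

  within-4 : ∀ u w → col u ≡ true → ∃ λ j → j ≤ 4 × inDist G j u w ≡ true
  within-4 u w cu = reach⇒inDist 4 u w (proj₁ (ecc u cu) w)

  Y-layers : ∀ u w → col u ≡ true → col w ≡ inDist G 0 u w ∨ inDist G 2 u w ∨ inDist G 4 u w
  Y-layers u w cu = ⇔→≡ (mk⇔ to from)
    where
    to : col w ≡ true → inDist G 0 u w ∨ inDist G 2 u w ∨ inDist G 4 u w ≡ true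
    to cw with within-4 u w cu
    ... | 0 , _ , d = ∨-trueˡ d
    ... | 1 , _ , d = ⊥-elim (not-¬ cw (inDist-colour 1 u w cu d))
    ... | 2 , _ , d = ∨-trueʳ {inDist G 0 u w} (∨-trueˡ d)
    ... | 3 , _ , d = ⊥-elim (not-¬ cw (inDist-colour 3 u w cu d))
    ... | 4 , _ , d = ∨-trueʳ {inDist G 0 u w} (∨-trueʳ {inDist G 2 u w} d)
    ... | suc (suc (suc (suc (suc _)))) , s≤s (s≤s (s≤s (s≤s ()))) , _
    from : inDist G 0 u w ∨ inDist G 2 u w ∨ inDist G 4 u w ≡ true → col w ≡ true
    from e with ∨-true⁻ {inDist G 0 u w} e
    ... | inj₁ d = inDist-colour 0 u w cu d
    ... | inj₂ e′ = [ inDist-colour 2 u w cu , inDist-colour 4 u w cu ] (∨-true⁻ {inDist G 2 u w} e′)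

  Y'-layers : ∀ u w → col u ≡ true → not (col w) ≡ inDist G 1 u w ∨ inDist G 3 u w
  Y'-layers u w cu = ⇔→≡ (mk⇔ to from)
    where
    to : not (col w) ≡ true → inDist G 1 u w ∨ inDist G 3 u w ≡ true
    to ncw with within-4 u w cu
    ... | 0 , _ , d = ⊥-elim (not-¬ (inDist-colour 0 u w cu d) (not-true⁻ ncw))
    ... | 1 , _ , d = ∨-trueˡ d
    ... | 2 , _ , d = ⊥-elim (not-¬ (inDist-colour 2 u w cu d) (not-true⁻ ncw))
    ... | 3 , _ , d = ∨-trueʳ {inDist G 1 u w} d
    ... | 4 , _ , d = ⊥-elim (not-¬ (inDist-colour 4 u w cu d) (not-true⁻ ncw))
    ... | suc (suc (suc (suc (suc _)))) , s≤s (s≤s (s≤s (s≤s ()))) , _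
    from : inDist G 1 u w ∨ inDist G 3 u w ≡ true → not (col w) ≡ true
    from e = cong not ([ inDist-colour 1 u w cu , inDist-colour 3 u w cu ] (∨-true⁻ {inDist G 1 u w} e))

  degree-via-Y-neighbour : ∀ x y → col x ≡ true → adj x y ≡ true → deg G y ≡ c 1 + b 1
  degree-via-Y-neighbour x y cx axy = begin
    count (adj y)
      ≡⟨ count-cong-⇔ (λ z → mk⇔ (split z) join) ⟩
    count (λ z → (adj y z ∧ inDist G 0 x z) ∨ (adj y z ∧ inDist G 2 x z))
      ≡⟨ count-∨ disjoint ⟩
    nbrsAt G 0 x y + nbrsAt G 2 x y
      ≡⟨ cong₂ _+_ (c-count 0 y cx d₁) (b-count 1 y cx d₁) ⟩
    c 1 + b 1
      ∎
    where
    d₁ : inDist G 1 x y ≡ true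
    d₁ = trans (inDist-one x y) axy
    split : ∀ z → adj y z ≡ true → (adj y z ∧ inDist G 0 x z) ∨ (adj y z ∧ inDist G 2 x z) ≡ true
    split z ayz with walk₂-end x y z cx axy ayz
    ... | inj₁ x≡z = ∨-trueˡ (∧-true ayz (⌊⌋-yes (x ≟ z) x≡z))
    ... | inj₂ d₂ = ∨-trueʳ {adj y z ∧ inDist G 0 x z} (∧-true ayz d₂)
    join : ∀ {z} → (adj y z ∧ inDist G 0 x z) ∨ (adj y z ∧ inDist G 2 x z) ≡ true → adj y z ≡ true
    join {z} e = [ ∧-trueˡ {adj y z} , ∧-trueˡ {adj y z} ] (∨-true⁻ {adj y z ∧ inDist G 0 x z} e)
    disjoint : ∀ z → adj y z ∧ inDist G 0 x z ≡ true → adj y z ∧ inDist G 2 x z ≡ true → ⊥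
    disjoint z e₀ e₂ =
      contradiction (inDist-functional {0} {2} x z (∧-trueʳ {adj y z} e₀) (∧-trueʳ {adj y z} e₂)) λ ()

  Y'-valency : ∀ y → col y ≡ false → deg G y ≡ c 1 + b 1
  Y'-valency y cy with within-4 u₀ y u₀∈Y
  ... | zero , _ , d = ⊥-elim (not-¬ (inDist-colour 0 u₀ y u₀∈Y d) cy)
  ... | suc j , _ , d =
    let (x , _ , axy) = inDist-pred j u₀ y d in degree-via-Y-neighbour x y (Y'-adj⇒Y x y cy axy) axy

  lam≡common-neighbours : ∀ p q → col p ≡ true → lam D p q ≡ nbrsAt G 1 p q
  lam≡common-neighbours p q cp = count-cong-⇔ (λ B → mk⇔ (to B) (from B))
    where
    to : ∀ B → not (col B) ∧ adj p B ∧ adj q B ≡ true → adj q B ∧ inDist G 1 p B ≡ true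
    to B e = let a = ∧-trueʳ {not (col B)} e in
      ∧-true (∧-trueʳ {adj p B} a) (trans (inDist-one p B) (∧-trueˡ a))
    from : ∀ B → adj q B ∧ inDist G 1 p B ≡ true → not (col B) ∧ adj p B ∧ adj q B ≡ true
    from B e = let apB = trans (sym (inDist-one p B)) (∧-trueʳ {adj q B} e) in
      ∧-true (cong not (Y-adj⇒Y' p B cp apB)) (∧-true apB (∧-trueˡ e))

  lam-at-distance-2 : ∀ p q → col p ≡ true → inDist G 2 p q ≡ true → lam D p q ≡ c 2
  lam-at-distance-2 p q cp d = trans (lam≡common-neighbours p q cp) (c-count 1 q cp d)

  lam-off-distance-2 : ∀ p q → col p ≡ true → q ≢ p → inDist G 2 p q ≡ false → lam D p q ≡ 0
  lam-off-distance-2 p q cp q≢p far = trans (lam≡common-neighbours p q cp) (count-none no-common)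
    where
    no-common : ∀ B → adj q B ∧ inDist G 1 p B ≡ false
    no-common B = ¬-not λ e →
      let apB = trans (sym (inDist-one p B)) (∧-trueʳ {adj q B} e)
          aBq = trans (adj-sym B q) (∧-trueˡ e)
      in [ q≢p ∘ sym , (λ d → not-¬ d far) ] (walk₂-end p B q cp apB aBq)

  c-nonzero : ∀ i u w → col u ≡ true → inDist G (suc i) u w ≡ true → c (suc i) ≢ 0
  c-nonzero i u w cu d c≡0 =
    let (x , dx , a) = inDist-pred i u w d in
    not-¬ (∧-true (trans (adj-sym w x) a) dx) (count≡0⇒false x (trans (c-count i w cu d) c≡0))

  c₂≢0 : c 2 ≢ 0
  c₂≢0 = let (w , d₄) = proj₂ (ecc u₀ u₀∈Y)
             (x , d₂) = inDist-down {j = 4} u₀ w (s≤s (s≤s z≤n)) d₄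
         in c-nonzero 1 u₀ x u₀∈Y d₂

  lam≟c₂ : ∀ p q → col p ≡ true → q ≢ p → ⌊ lam D p q ℕ.≟ c 2 ⌋ ≡ inDist G 2 p q
  lam≟c₂ p q cp q≢p with inDist G 2 p q in d
  ... | true  = ⌊⌋-yes (_ ℕ.≟ _) (lam-at-distance-2 p q cp d)
  ... | false = ⌊⌋-no (_ ℕ.≟ _) (λ eq → c₂≢0 (trans (sym eq) (lam-off-distance-2 p q cp q≢p d)))

  pair-lam : ∀ p q → col p ≡ true → col q ≡ true → p ≢ q → lam D p q ≡ c 2 ⊎ lam D p q ≡ 0
  pair-lam p q cp _ p≢q with inDist G 2 p q in d
  ... | true  = inj₁ (lam-at-distance-2 p q cp d)
  ... | false = inj₂ (lam-off-distance-2 p q cp (p≢q ∘ sym) d)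

  replication : ∀ p → col p ≡ true → count (λ B → not (col B) ∧ adj p B) ≡ b 0
  replication p cp = trans (count-cong-⇔ (λ B → mk⇔ (to B) (from B))) (b-count 0 p cp (reach-refl 0 p))
    where
    to : ∀ B → not (col B) ∧ adj p B ≡ true → adj p B ∧ inDist G 1 p B ≡ true
    to B e = let apB = ∧-trueʳ {not (col B)} e in ∧-true apB (trans (inDist-one p B) apB)
    from : ∀ B → adj p B ∧ inDist G 1 p B ≡ true → not (col B) ∧ adj p B ≡ true
    from B e = let apB = ∧-trueˡ e in ∧-true (cong not (Y-adj⇒Y' p B cp apB)) apB

  block-size : ∀ B → not (col B) ≡ true → count (λ p → col p ∧ adj p B) ≡ c 1 + b 1
  block-size B ncB = trans (count-cong-⇔ (λ p → mk⇔ (to p) (from p))) (Y'-valency B cB)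
    where
    cB = not-true⁻ ncB
    to : ∀ p → col p ∧ adj p B ≡ true → adj B p ≡ true
    to p e = trans (adj-sym B p) (∧-trueʳ {col p} e)
    from : ∀ p → adj B p ≡ true → col p ∧ adj p B ≡ true
    from p a = let apB = trans (adj-sym p B) a in ∧-true (Y'-adj⇒Y p B cB apB) apB

  flag-count : ∀ p B → col p ≡ true → not (col B) ≡ true → adj p B ≡ true →
    count (λ q → col q ∧ adj q B ∧ not ⌊ q ≟ p ⌋ ∧ ⌊ lam D p q ℕ.≟ c 2 ⌋) ≡ b 1
  flag-count p B cp _ apB =
    trans (count-cong-⇔ (λ q → mk⇔ (to q) (from q))) (b-count 1 B cp (trans (inDist-one p B) apB))
    where
    flagged at-distance-2 : Fin n → Bool
    flagged q = col q ∧ adj q B ∧ not ⌊ q ≟ p ⌋ ∧ ⌊ lam D p q ℕ.≟ c 2 ⌋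
    at-distance-2 q = adj B q ∧ inDist G 2 p q
    to : ∀ q → flagged q ≡ true → at-distance-2 q ≡ true
    to q e =
      let e₁ = ∧-trueʳ {col q} e
          e₂ = ∧-trueʳ {adj q B} e₁
          q≢p = ⌊⌋-no⁻¹ (q ≟ p) (not-true⁻ (∧-trueˡ e₂))
      in ∧-true (trans (adj-sym B q) (∧-trueˡ e₁))
                (trans (sym (lam≟c₂ p q cp q≢p)) (∧-trueʳ {not ⌊ q ≟ p ⌋} e₂))
    from : ∀ q → at-distance-2 q ≡ true → flagged q ≡ true
    from q e =
      let d = ∧-trueʳ {adj B q} e
          q≢p = inDist-suc⇒≢ 1 p q d ∘ sym
      in ∧-true (inDist-colour 2 p q cp d)
           (∧-true (trans (adj-sym q B) (∧-trueˡ e))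
             (∧-true (cong not (⌊⌋-no (q ≟ p) q≢p)) (trans (lam≟c₂ p q cp q≢p) d)))

  nonflag-count : ∀ p B → col p ≡ true → not (col B) ≡ true → adj p B ≡ false →
    count (λ q → col q ∧ adj q B ∧ ⌊ lam D p q ℕ.≟ c 2 ⌋) ≡ c 3
  nonflag-count p B cp ncB p∉B = trans (count-cong-⇔ (λ q → mk⇔ (to q) (from q))) (c-count 2 B cp d₃)
    where
    d₃ : inDist G 3 p B ≡ true
    d₃ with ∨-true⁻ {inDist G 1 p B} (trans (sym (Y'-layers p B cp)) ncB)
    ... | inj₁ d₁ = ⊥-elim (not-¬ (trans (sym (inDist-one p B)) d₁) p∉B)
    ... | inj₂ d₃ = d₃
    flagged at-distance-2 : Fin n → Bool
    flagged q = col q ∧ adj q B ∧ ⌊ lam D p q ℕ.≟ c 2 ⌋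
    at-distance-2 q = adj B q ∧ inDist G 2 p q
    to : ∀ q → flagged q ≡ true → at-distance-2 q ≡ true
    to q e =
      let e₁ = ∧-trueʳ {col q} e
          aqB = ∧-trueˡ e₁
          q≢p : q ≢ p
          q≢p q≡p = not-¬ (subst (λ z → adj z B ≡ true) q≡p aqB) p∉B
      in ∧-true (trans (adj-sym B q) aqB) (trans (sym (lam≟c₂ p q cp q≢p)) (∧-trueʳ {adj q B} e₁))
    from : ∀ q → at-distance-2 q ≡ true → flagged q ≡ true
    from q e =
      let d = ∧-trueʳ {adj B q} e
      in ∧-true (inDist-colour 2 p q cp d)
           (∧-true (trans (adj-sym q B) (∧-trueˡ e)) (trans (lam≟c₂ p q cp (inDist-suc⇒≢ 1 p q d ∘ sym)) d))

  sphere : ℕ → ℕ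
  sphere i = count (inDist G i u₀)

  sphere-0 : sphere 0 ≡ 1
  sphere-0 = count-≟ u₀

  sphere-1 : sphere 1 ≡ b 0
  sphere-1 = trans (count-cong (λ x → sym (trans (cong (_∧ inDist G 1 u₀ x) (sym (inDist-one u₀ x))) (∧-idem _))))
                   (b-count 0 u₀ u₀∈Y (reach-refl 0 u₀))

  sphere-recurrence : ∀ i → sphere i * b i ≡ sphere (suc i) * c (suc i)
  sphere-recurrence i = double-count (λ w x → inDist G i u₀ w ∧ adj w x ∧ inDist G (suc i) u₀ x) rows columns
    where
    rows : ∀ w → count (λ x → inDist G i u₀ w ∧ adj w x ∧ inDist G (suc i) u₀ x)
                 ≡ (if inDist G i u₀ w then b i else 0)
    rows w with inDist G i u₀ w in dᵢ
    ... | true  = b-count i w u₀∈Y dᵢ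
    ... | false = count-none {n} (λ _ → refl)
    columns : ∀ x → count (λ w → inDist G i u₀ w ∧ adj w x ∧ inDist G (suc i) u₀ x)
                    ≡ (if inDist G (suc i) u₀ x then c (suc i) else 0)
    columns x with inDist G (suc i) u₀ x in dᵢ₊₁
    ... | true  = trans (count-cong λ w → trans (cong (inDist G i u₀ w ∧_) (trans (∧-identityʳ _) (adj-sym w x)))
                                               (∧-comm (inDist G i u₀ w) (adj x w)))
                        (c-count i x u₀∈Y dᵢ₊₁)
    ... | false = count-none λ w → trans (cong (inDist G i u₀ w ∧_) (∧-zeroʳ (adj w x))) (∧-zeroʳ _)

  points-by-layer : count col ≡ sphere 0 + (sphere 2 + sphere 4)
  points-by-layer = begin
    count col
      ≡⟨ count-cong (λ w → Y-layers u₀ w u₀∈Y) ⟩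
    count (λ w → inDist G 0 u₀ w ∨ inDist G 2 u₀ w ∨ inDist G 4 u₀ w)
      ≡⟨ count-∨ apart₀ ⟩
    sphere 0 + count (λ w → inDist G 2 u₀ w ∨ inDist G 4 u₀ w)
      ≡⟨ cong (sphere 0 +_) (count-∨ apart₂) ⟩
    sphere 0 + (sphere 2 + sphere 4)
      ∎
    where
    apart₀ : ∀ w → inDist G 0 u₀ w ≡ true → inDist G 2 u₀ w ∨ inDist G 4 u₀ w ≡ true → ⊥
    apart₀ w d₀ e with ∨-true⁻ {inDist G 2 u₀ w} e
    ... | inj₁ d₂ = contradiction (inDist-functional {0} {2} u₀ w d₀ d₂) λ ()
    ... | inj₂ d₄ = contradiction (inDist-functional {0} {4} u₀ w d₀ d₄) λ ()
    apart₂ : ∀ w → inDist G 2 u₀ w ≡ true → inDist G 4 u₀ w ≡ true → ⊥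
    apart₂ w d₂ d₄ = contradiction (inDist-functional {2} {4} u₀ w d₂ d₄) λ ()

  blocks-by-layer : count (λ x → not (col x)) ≡ sphere 1 + sphere 3
  blocks-by-layer = trans (count-cong (λ w → Y'-layers u₀ w u₀∈Y))
                          (count-∨ (λ w d₁ d₃ → contradiction (inDist-functional {1} {3} u₀ w d₁ d₃) λ ()))

  sphere-2 : sphere 2 * c 2 ≡ b 0 * b 1
  sphere-2 = trans (sym (sphere-recurrence 1)) (cong (_* b 1) sphere-1)

  sphere-3 : sphere 3 * (c 2 * c 3) ≡ b 0 * b 1 * b 2
  sphere-3 = product-step (sphere 2) (sphere 3) sphere-2 (sphere-recurrence 2)

  sphere-4 : sphere 4 * (c 2 * c 3 * c 4) ≡ b 0 * b 1 * b 2 * b 3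
  sphere-4 = product-step (sphere 3) (sphere 4) sphere-3 (sphere-recurrence 3)

  number-of-points :
    count col * (c 2 * c 3 * c 4) ≡ c 2 * c 3 * c 4 + b 0 * b 1 * c 3 * c 4 + b 0 * b 1 * b 2 * b 3
  number-of-points = begin
    count col * C
      ≡⟨ cong (_* C) points-by-layer ⟩
    (sphere 0 + (sphere 2 + sphere 4)) * C
      ≡⟨ cong (λ s → (s + (sphere 2 + sphere 4)) * C) sphere-0 ⟩
    (1 + (sphere 2 + sphere 4)) * C
      ≡⟨ expand (sphere 2) (sphere 4) (c 2) (c 3) (c 4) ⟩
    C + sphere 2 * c 2 * c 3 * c 4 + sphere 4 * C
      ≡⟨ cong₂ (λ x y → C + x * c 3 * c 4 + y) sphere-2 sphere-4 ⟩
    C + b 0 * b 1 * c 3 * c 4 + b 0 * b 1 * b 2 * b 3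
      ∎
    where
    C = c 2 * c 3 * c 4
    expand : ∀ x y a b c → (1 + (x + y)) * (a * b * c) ≡ a * b * c + x * a * b * c + y * (a * b * c)
    expand = solve-∀

  number-of-blocks : count (λ x → not (col x)) * (c 2 * c 3) ≡ b 0 * (c 2 * c 3) + b 0 * b 1 * b 2
  number-of-blocks = begin
    count (λ x → not (col x)) * C       ≡⟨ cong (_* C) blocks-by-layer ⟩
    (sphere 1 + sphere 3) * C           ≡⟨ *-distribʳ-+ C (sphere 1) (sphere 3) ⟩
    sphere 1 * C + sphere 3 * C         ≡⟨ cong₂ _+_ (cong (_* C) sphere-1) sphere-3 ⟩
    b 0 * C + b 0 * b 1 * b 2           ∎
    where
    C = c 2 * c 3

lemma5p1 : ∀ {n} (G : Graph n) (col : Fin n → Bool) (b c : ℕ → ℕ) →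
    Connected G → IsBipartition G col → DistSemiregular G col b c →
    (∀ u → col u ≡ true → Eccentricity G u 4) →
    ∃ λ b'₀ → (∀ y → col y ≡ false → deg G y ≡ b'₀) ×
      ∃ λ v → ∃ λ bb →
        (v * (c 2 * c 3 * c 4) ≡ c 2 * c 3 * c 4 + b 0 * b 1 * c 3 * c 4 + b 0 * b 1 * b 2 * b 3)
        × (bb * (c 2 * c 3) ≡ b 0 * (c 2 * c 3) + b 0 * b 1 * b 2)
        × IsSPBIBD (pointsBlocks G col) v bb (b 0) b'₀ (c 2) 0 (b 1) (c 3)
lemma5p1 G col b c _ bip dsr ecc =
  c 1 + b 1 , Y'-valency , count col , count (λ x → not (col x)) , number-of-points , number-of-blocks ,
  record
    { nPoints      = refl
    ; nBlocks      = refl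
    ; blockSize    = block-size
    ; repl         = replication
    ; pairs        = pair-lam
    ; flagCount    = flag-count
    ; nonflagCount = nonflag-count
    }
  where
  open Semiregular G col b c bip dsr ecc
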